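{- Let \(\mathcal U,\mathcal V\) be universes and \(P_{\mathcal U}:\mathcal U\) a proposition, and let \(\mathcal T\) be any universe. If the poset \(\mathcal L_{\mathcal V}(P_{\mathcal U})\) has suprema for all subsets \(\mathcal L_{\mathcal V}(P_{\mathcal U})\to\Omega_{\mathcal T}\), then \(P_{\mathcal U}\) is \(\mathcal V\)-small.
   Context: Work in univalent foundations (intensional Martin-Löf type theory with universes, function and propositional extensionality, propositional truncations). \(\Omega_{\mathcal V}\) is the type of propositions in \(\mathcal V\). Define \(\mathcal L_{\mathcal V}(P_{\mathcal U}):=\Sigma_{Q:\Omega_{\mathcal V}}(Q\to P_{\mathcal U})\), ordered by implication of first components (it is a subtype of \(\Omega_{\mathcal V}\) closed under suprema of families indexed by types in \(\mathcal V\)). A subset of a type \(X\) is a map \(S:X\to\Omega_{\mathcal T}\); a supremum of \(S\) is a least upper bound of \(\{x\mid S(x)\}\). A type is \(\mathcal V\)-small if it is equivalent to a type in \(\mathcal V\). -}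

module Defs where

open import Level using (Level; _⊔_; Setω) renaming (suc to lsuc)
open import Data.Product using (Σ; Σ-syntax; _×_; _,_; proj₁; proj₂)
open import Relation.Binary.PropositionalEquality using (_≡_)
open import Axiom.Extensionality.Propositional using (Extensionality)
open import Function.Bundles using (_↔_)

isProp : ∀ {ℓ} → Set ℓ → Set ℓ
isProp A = (x y : A) → x ≡ y

FunExt : Setω
FunExt = ∀ {a b} → Extensionality a b

PropExt : Setω
PropExt = ∀ {ℓ} {P Q : Set ℓ} → isProp P → isProp Q → (P → Q) → (Q → P) → P ≡ Q

Ω : (v : Level) → Set (lsuc v)
Ω v = Σ[ Q ∈ Set v ] isProp Q

𝓛 : (v : Level) {u : Level} → Set u → Set (lsuc v ⊔ u)
𝓛 v P = Σ[ Q ∈ Ω v ] (proj₁ Q → P)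

_⊑_ : ∀ {v u} {P : Set u} → 𝓛 v P → 𝓛 v P → Set v
x ⊑ y = proj₁ (proj₁ x) → proj₁ (proj₁ y)

isUpperBound : ∀ {v u t} {P : Set u} → (𝓛 v P → Ω t) → 𝓛 v P → Set (lsuc v ⊔ u ⊔ t ⊔ v)
isUpperBound S s = ∀ x → proj₁ (S x) → x ⊑ s

isSup : ∀ {v u t} {P : Set u} → (𝓛 v P → Ω t) → 𝓛 v P → Set (lsuc v ⊔ u ⊔ t)
isSup S s = isUpperBound S s × (∀ y → isUpperBound S y → s ⊑ y)

hasSup : ∀ {v u t} {P : Set u} → (𝓛 v P → Ω t) → Set (lsuc v ⊔ u ⊔ t)
hasSup {v} {P = P} S = Σ[ s ∈ 𝓛 v P ] isSup S s

hasAllSups : (t v : Level) {u : Level} (P : Set u) → Set (lsuc v ⊔ u ⊔ lsuc t)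
hasAllSups t v P = (S : 𝓛 v P → Ω t) → hasSup S

isSmall : (v : Level) {u : Level} → Set u → Set (lsuc v ⊔ u)
isSmall v X = Σ[ Y ∈ Set v ] (Y ↔ X)

{-# OPTIONS --safe #-}
module Submission where

open import Level using (Level)
open import Defs
open import Data.Product using (_,_; proj₁; proj₂)
open import Data.Unit.Polymorphic using (⊤; tt)
open import Function.Bundles using (_↔_; mk↔ₛ′)
open import Relation.Binary.PropositionalEquality using (refl)

-- Take the supremum (Q , Q → P) of the total subset. Each p : P gives the
-- element (⊤ , const p), which lies below the supremum, so P → Q as well;
-- hence Q : 𝓥 is logically equivalent to P, and both are propositions.

⊤Ω : (l : Level) → Ω l
⊤Ω l = ⊤ , λ _ _ → refl

totalSubset : ∀ t {v u} {P : Set u} → 𝓛 v P → Ω t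
totalSubset t _ = ⊤Ω t

pointOf𝓛 : ∀ v {u} {P : Set u} → P → 𝓛 v P
pointOf𝓛 v p = ⊤Ω v , λ _ → p

isProp↔ : ∀ {a b} {A : Set a} {B : Set b} → isProp A → isProp B →
          (A → B) → (B → A) → A ↔ B
isProp↔ pA pB f g = mk↔ₛ′ f g (λ _ → pB _ _) (λ _ → pA _ _)

sup-total↔P : ∀ {t v u} {P : Set u} → isProp P →
              (s : 𝓛 v P) → isSup (totalSubset t) s → proj₁ (proj₁ s) ↔ P
sup-total↔P {v = v} pP ((Q , pQ) , Q→P) (upper , _) =
  isProp↔ pQ pP Q→P (λ p → upper (pointOf𝓛 v p) tt tt)

theorem6p1 : FunExt → PropExt →
    (u v t : Level) (P : Set u) → isProp P →
    hasAllSups t v P → isSmall v P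
theorem6p1 _ _ u v t P pP sups =
  let (s , s-isSup) = sups (totalSubset t)
  in proj₁ (proj₁ s) , sup-total↔P pP s s-isSup
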